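{- Let $T$ be a tree with at least $3$ vertices such that $\Psi(T)=\Psi(T-x)$ for every leaf $x$ of $T$. Then every vertex of $T$ that is not a leaf is adjacent to exactly one leaf of $T$.
   Context: A matching of a graph is a set of edges no two of which share a vertex; it is maximal if it is not properly contained in another matching. $\Psi(G)$ denotes the number of maximal matchings of $G$. A leaf is a vertex of degree $1$. -}

module Defs where

open import Data.Nat using (ℕ; zero; suc; _<ᵇ_; _≡ᵇ_)
open import Data.Bool using (Bool; true; false; _∧_; _∨_; not; if_then_else_)
open import Data.Fin using (Fin; toℕ; punchIn)
open import Data.Fin.Properties using (_≟_)
open import Data.List using (List; []; _∷_; length; filter; concatMap; allFin; map; zip)

allᵇ : ∀ {A : Set} → (A → Bool) → List A → Bool
allᵇ p []       = true
allᵇ p (x ∷ xs) = p x ∧ allᵇ p xs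

anyᵇ : ∀ {A : Set} → (A → Bool) → List A → Bool
anyᵇ p []       = false
anyᵇ p (x ∷ xs) = p x ∨ anyᵇ p xs
open import Data.List.Relation.Unary.AllPairs using (AllPairs)
open import Data.List.Relation.Unary.All using (All)
open import Data.Product using (_×_; _,_; Σ; ∃)
open import Relation.Binary.PropositionalEquality using (_≡_)
open import Relation.Nullary using (¬_; does)

record Graph (n : ℕ) : Set where
  field
    adj    : Fin n → Fin n → Bool
    sym    : ∀ i j → adj i j ≡ adj j i
    irrefl : ∀ i → adj i i ≡ false
open Graph public

Adj : ∀ {n} → Graph n → Fin n → Fin n → Set
Adj G i j = adj G i j ≡ true

degree : ∀ {n} → Graph n → Fin n → ℕ
degree G v = length (filter (λ u → adj G v u ≡? true) (allFin _))
  where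
  _≡?_ : (a b : Bool) → Relation.Nullary.Dec (a ≡ b)
  _≡?_ = Data.Bool._≟_
    where import Data.Bool

isLeaf : ∀ {n} → Graph n → Fin n → Bool
isLeaf G v = degree G v ≡ᵇ 1

Leaf : ∀ {n} → Graph n → Fin n → Set
Leaf G v = degree G v ≡ 1

leafNeighbours : ∀ {n} → Graph n → Fin n → ℕ
leafNeighbours G v =
  length (filter (λ u → Data.Bool._≟_ (adj G v u ∧ isLeaf G u) true) (allFin _))
  where import Data.Bool

data Walk {n} (G : Graph n) : Fin n → Fin n → Set where
  here : ∀ {v} → Walk G v v
  step : ∀ {u w v} → Adj G u w → Walk G w v → Walk G u v

Connected : ∀ {n} → Graph n → Set
Connected G = ∀ u v → Walk G u v

Chain : ∀ {n} → Graph n → List (Fin n) → Set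
Chain G []           = Data.Unit.⊤ where import Data.Unit
Chain G (u ∷ [])     = Data.Unit.⊤ where import Data.Unit
Chain G (u ∷ w ∷ vs) = Adj G u w × Chain G (w ∷ vs)

Cycle : ∀ {n} → Graph n → Set
Cycle {n} G = Σ (Fin n) λ v0 → Σ (Fin n) λ v1 → Σ (Fin n) λ v2 → Σ (List (Fin n)) λ rest →
  let cyc = v0 ∷ v1 ∷ v2 ∷ rest in
  AllPairs (λ a b → ¬ a ≡ b) cyc × Chain G cyc × Adj G (last v2 rest) v0
  where
  last : Fin n → List (Fin n) → Fin n
  last x []       = x
  last x (y ∷ ys) = last y ys

Acyclic : ∀ {n} → Graph n → Set
Acyclic G = ¬ Cycle G

IsTree : ∀ {n} → Graph n → Set
IsTree G = Connected G × Acyclic G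

delete : ∀ {n} → Graph (suc n) → Fin (suc n) → Graph n
delete G x = record
  { adj    = λ i j → adj G (punchIn x i) (punchIn x j)
  ; sym    = λ i j → sym G (punchIn x i) (punchIn x j)
  ; irrefl = λ i → irrefl G (punchIn x i)
  }

edges : ∀ {n} → Graph n → List (Fin n × Fin n)
edges {n} G = concatMap (λ i → map (λ j → (i , j))
                (filter (λ j → Data.Bool._≟_ ((toℕ i <ᵇ toℕ j) ∧ adj G i j) true) (allFin n)))
                (allFin n)
  where import Data.Bool

-- subsets of a list, as Bool masks
masks : ℕ → List (List Bool)
masks zero    = [] ∷ []
masks (suc m) = concatMap (λ s → (true ∷ s) ∷ (false ∷ s) ∷ []) (masks m)

select : ∀ {A : Set} → List Bool → List A → List A
select (true ∷ bs)  (x ∷ xs) = x ∷ select bs xs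
select (false ∷ bs) (x ∷ xs) = select bs xs
select _ _ = []

eqᵇ : ∀ {n} → Fin n → Fin n → Bool
eqᵇ a b = does (a ≟ b)

disjointᵇ : ∀ {n} → Fin n × Fin n → Fin n × Fin n → Bool
disjointᵇ (a , b) (c , d) = not (eqᵇ a c ∨ eqᵇ a d ∨ eqᵇ b c ∨ eqᵇ b d)

pairwiseᵇ : ∀ {A : Set} → (A → A → Bool) → List A → Bool
pairwiseᵇ R []       = true
pairwiseᵇ R (x ∷ xs) = allᵇ (R x) xs ∧ pairwiseᵇ R xs

isMatchingᵇ : ∀ {n} → List (Fin n × Fin n) → Bool
isMatchingᵇ M = pairwiseᵇ disjointᵇ M

subsetᵇ : List Bool → List Bool → Bool
subsetᵇ s t = allᵇ (λ p → not (Data.Product.proj₁ p) ∨ Data.Product.proj₂ p) (zip s t)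
  where import Data.Product

eqMaskᵇ : List Bool → List Bool → Bool
eqMaskᵇ s t = allᵇ (λ p → Data.Bool._≟_ (Data.Product.proj₁ p) (Data.Product.proj₂ p) .does) (zip s t)
  where import Data.Bool; import Data.Product

properSubsetᵇ : List Bool → List Bool → Bool
properSubsetᵇ s t = subsetᵇ s t ∧ not (eqMaskᵇ s t)

isMaximalMatchingᵇ : ∀ {n} → Graph n → List Bool → Bool
isMaximalMatchingᵇ G s =
  isMatchingᵇ (select s E) ∧
  not (anyᵇ (λ t → isMatchingᵇ (select t E) ∧ properSubsetᵇ s t) (masks (length E)))
  where E = edges G

Ψ : ∀ {n} → Graph n → ℕ
Ψ G = length (filter (λ s → Data.Bool._≟_ (isMaximalMatchingᵇ G s) true) (masks (length (edges G))))
  where import Data.Bool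

-- Let x be a leaf of T with neighbour y. A maximal matching M′ of T − x lifts to the maximal
-- matching of T obtained by adding the edge xy exactly when M′ leaves y uncovered, and lifting is
-- injective. Suppose y has a further neighbour w ≠ x whose neighbours other than y are not leaves
-- (a pendant path x y w). Take xy, block every neighbour u ≠ y of w by an edge u z with z ≠ w
-- (these edges are disjoint because T has no triangles or 4-cycles), and extend greedily: the result
-- is a maximal matching of T leaving w uncovered. It is not a lift, since a lift containing xy comes
-- from a matching of T − x that must meet the edge yw, and it meets it at w. So Ψ(T − x) < Ψ(T).
-- A non-leaf v with two leaf neighbours u, u′ gives the pendant path u v u′. If v has no leaf
-- neighbour, walk from v without backtracking through non-leaves without leaf neighbours; the walk
-- ends, as T is a finite tree, at a vertex y with a leaf neighbour x, and the previous vertex is w.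

module Submission where

open import Defs hiding (sym)
open import Data.Nat using (ℕ; zero; suc; _+_; _≤_; _<_; z≤n; s≤s; _<ᵇ_)
open import Data.Fin using (Fin; zero; suc; toℕ; punchIn; punchOut)
open import Data.Fin.Properties using (_≟_; toℕ-injective; punchIn-injective; punchInᵢ≢i; punchIn-mono-≤; punchIn-cancel-≤; punchIn-punchOut)
open import Data.Nat.Properties using (≤-reflexive; ≤-trans; ≤-antisym; suc-injective; <ᵇ⇒<; <⇒<ᵇ; ≡ᵇ⇒≡; ≡⇒≡ᵇ; m<m+n; <⇒≱; ≰⇒>; ≮⇒≥; ≤∧≢⇒<; <-asym; <-irrefl; +-suc) renaming (_≟_ to _≟ℕ_)
open import Data.Bool using (Bool; true; false; _∧_; not; T; if_then_else_) renaming (_≟_ to _≟𝔹_)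
open import Data.Bool.Properties using (not-injective; not-¬; ∧-zeroʳ; T-≡)
open import Function.Bundles using (Equivalence)
open import Data.List using (List; []; _∷_; _++_; length; map; concatMap; filter; allFin)
open import Data.List.Properties using (length-map; length-++-sucʳ; ∷-injective; ++-assoc; length-tabulate)
open import Data.List.Membership.Propositional using (_∈_; _∉_; find; lose)
open import Data.List.Membership.Propositional.Properties using (∈-∃++; ∈-++⁻; ∈-++⁺ˡ; ∈-++⁺ʳ; ∈-map⁺; ∈-map⁻; ∈-concatMap⁻; ∈-concatMap⁺; ∈-filter⁺; ∈-filter⁻; ∈-allFin)
open import Data.List.Relation.Binary.Subset.Propositional using (_⊆_)
open import Data.List.Relation.Unary.Any using (Any; here; there; any?)
open import Data.List.Relation.Unary.All using (All; []; _∷_)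
import Data.List.Relation.Unary.All as All
import Data.List.Relation.Unary.All.Properties as All
open import Data.List.Relation.Unary.AllPairs using (AllPairs; []; _∷_)
open import Data.List.Relation.Unary.Unique.Propositional using (Unique)
import Data.List.Relation.Unary.Unique.Propositional.Properties as Unique
open import Data.Product using (Σ; _×_; _,_; ∃; proj₁; proj₂; map₁)
open import Data.Sum using (_⊎_; inj₁; inj₂; map₂)
open import Data.Empty using (⊥; ⊥-elim)
open import Relation.Binary.PropositionalEquality
open import Relation.Binary.Definitions using (DecidableEquality)
open import Relation.Unary using (Decidable)
open import Data.Product.Properties using (≡-dec)
open import Relation.Nullary using (¬_; ¬?; Dec; yes; no; does; _⊎-dec_; _×-dec_)
open import Function using (id)
open import Data.Unit using (tt)
open import Relation.Nullary.Decidable using (map′; dec-true; dec-false)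

private variable
  A B : Set

Unique-⊆⇒length≤ : {xs ys : List A} → Unique xs → xs ⊆ ys → length xs ≤ length ys
Unique-⊆⇒length≤ {xs = []} _ _ = z≤n
Unique-⊆⇒length≤ {xs = x ∷ xs} (x∉xs ∷ !xs) xs⊆ys with ∈-∃++ (xs⊆ys (here refl))
... | ys₁ , ys₂ , refl = ≤-trans (s≤s (Unique-⊆⇒length≤ !xs xs⊆ys₁++ys₂))
                                 (≤-reflexive (sym (length-++-sucʳ ys₁ x ys₂)))
  where
  xs⊆ys₁++ys₂ : xs ⊆ ys₁ ++ ys₂
  xs⊆ys₁++ys₂ {z} z∈xs with ∈-++⁻ ys₁ (xs⊆ys (there z∈xs))
  ... | inj₁ z∈ys₁ = ∈-++⁺ˡ z∈ys₁
  ... | inj₂ (here refl) = ⊥-elim (All.lookup x∉xs z∈xs refl)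
  ... | inj₂ (there z∈ys₂) = ∈-++⁺ʳ ys₁ z∈ys₂

Injective-on : (A → B) → List A → Set
Injective-on f xs = ∀ {a b} → a ∈ xs → b ∈ xs → f a ≡ f b → a ≡ b

Unique-map⁺ : {f : A → B} {xs : List A} → Injective-on f xs → Unique xs → Unique (map f xs)
Unique-map⁺ {xs = []} _ [] = []
Unique-map⁺ {f = f} {xs = x ∷ xs} inj (x∉xs ∷ !xs) =
  fresh xs x∉xs (λ b∈ → inj (here refl) (there b∈)) ∷ Unique-map⁺ (λ a∈ b∈ → inj (there a∈) (there b∈)) !xs
  where
  fresh : ∀ ys → All (x ≢_) ys → (∀ {b} → b ∈ ys → f x ≡ f b → x ≡ b) → All (f x ≢_) (map f ys)
  fresh [] [] _ = []
  fresh (y ∷ ys) (x≢y ∷ x∉ys) inj′ = (λ e → x≢y (inj′ (here refl) e)) ∷ fresh ys x∉ys (λ b∈ → inj′ (there b∈))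

∉⇒All≢ : {x : A} (ys : List A) → x ∉ ys → All (x ≢_) ys
∉⇒All≢ [] _ = []
∉⇒All≢ (y ∷ ys) x∉ = (λ e → x∉ (here e)) ∷ ∉⇒All≢ ys (λ p → x∉ (there p))

injection-missing⇒length< : (f : A → B) {xs : List A} {ys : List B} → Unique xs →
  Injective-on f xs → (∀ {a} → a ∈ xs → f a ∈ ys) →
  (b : B) → b ∈ ys → (∀ {a} → a ∈ xs → f a ≢ b) → length xs < length ys
injection-missing⇒length< f {xs} {ys} !xs inj f∈ b b∈ b∉img =
  subst (λ k → suc k ≤ length ys) (length-map f xs)
    (Unique-⊆⇒length≤ (∉⇒All≢ (map f xs) b∉ ∷ Unique-map⁺ inj !xs) b∷img⊆ys)
  where
  b∉ : b ∉ map f xs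
  b∉ p with ∈-map⁻ f p
  ... | a , a∈ , e = b∉img a∈ (sym e)
  b∷img⊆ys : b ∷ map f xs ⊆ ys
  b∷img⊆ys (here refl) = b∈
  b∷img⊆ys (there p) with ∈-map⁻ f p
  ... | a , a∈ , refl = f∈ a∈

Unique-concatMap⁺ : (f : A → List B) {xs : List A} → Unique xs → (∀ a → Unique (f a)) →
  (∀ {a a′ b} → b ∈ f a → b ∈ f a′ → a ≡ a′) → Unique (concatMap f xs)
Unique-concatMap⁺ f {[]} _ _ _ = []
Unique-concatMap⁺ f {a ∷ xs} (a∉xs ∷ !xs) !f separated =
  Unique.++⁺ (!f a) (Unique-concatMap⁺ f !xs !f separated) disjoint
  where
  disjoint : ∀ {b} → b ∈ f a × b ∈ concatMap f xs → ⊥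
  disjoint (b∈fa , b∈rest) with find (∈-concatMap⁻ f b∈rest)
  ... | a′ , a′∈xs , b∈fa′ = All.lookup a∉xs a′∈xs (separated b∈fa b∈fa′)

∧-true⁻ : ∀ {a b} → a ∧ b ≡ true → a ≡ true × b ≡ true
∧-true⁻ {true} refl = refl , refl

∧-true⁺ : ∀ {a b} → a ≡ true → b ≡ true → a ∧ b ≡ true
∧-true⁺ refl refl = refl

not-true⁻ : ∀ {a} → not a ≡ true → a ≡ false
not-true⁻ = not-injective

does-true⁻ : ∀ {P : Set} (p? : Dec P) → does p? ≡ true → P
does-true⁻ (yes p) _ = p

anyᵇ-true⁺ : ∀ {p : A → Bool} {x xs} → x ∈ xs → p x ≡ true → anyᵇ p xs ≡ true
anyᵇ-true⁺ {p = p} {xs = y ∷ ys} (here refl) px rewrite px = refl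
anyᵇ-true⁺ {p = p} {xs = y ∷ ys} (there x∈) px with p y
... | true = refl
... | false = anyᵇ-true⁺ x∈ px

anyᵇ-false⁺ : ∀ {p : A → Bool} xs → (∀ {x} → x ∈ xs → p x ≡ false) → anyᵇ p xs ≡ false
anyᵇ-false⁺ [] _ = refl
anyᵇ-false⁺ (y ∷ ys) h rewrite h (here refl) = anyᵇ-false⁺ ys (λ x∈ → h (there x∈))

allᵇ-true⁺ : ∀ {p : A → Bool} xs → (∀ {x} → x ∈ xs → p x ≡ true) → allᵇ p xs ≡ true
allᵇ-true⁺ [] _ = refl
allᵇ-true⁺ (y ∷ ys) h = ∧-true⁺ (h (here refl)) (allᵇ-true⁺ ys (λ x∈ → h (there x∈)))

allᵇ-true⁻ : ∀ {p : A → Bool} {x xs} → allᵇ p xs ≡ true → x ∈ xs → p x ≡ true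
allᵇ-true⁻ h (here refl) = proj₁ (∧-true⁻ h)
allᵇ-true⁻ h (there x∈) = allᵇ-true⁻ (proj₂ (∧-true⁻ h)) x∈

private
  extensions : List Bool → List (List Bool)
  extensions s = (true ∷ s) ∷ (false ∷ s) ∷ []

masks-length : ∀ m {s} → s ∈ masks m → length s ≡ m
masks-length zero (here refl) = refl
masks-length (suc m) s∈ with find (∈-concatMap⁻ extensions {xs = masks m} s∈)
... | s , s∈m , here refl = cong suc (masks-length m s∈m)
... | s , s∈m , there (here refl) = cong suc (masks-length m s∈m)

∈-masks : ∀ s → s ∈ masks (length s)
∈-masks [] = here refl
∈-masks (true ∷ s) = ∈-concatMap⁺ extensions {xs = masks (length s)} (lose (∈-masks s) (here refl))
∈-masks (false ∷ s) = ∈-concatMap⁺ extensions {xs = masks (length s)} (lose (∈-masks s) (there (here refl)))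

masks-Unique : ∀ m → Unique (masks m)
masks-Unique zero = [] ∷ []
masks-Unique (suc m) = Unique-concatMap⁺ extensions (masks-Unique m) (λ _ → ((λ ()) ∷ []) ∷ [] ∷ []) same-tail
  where
  same-tail : ∀ {s s′ t} → t ∈ extensions s → t ∈ extensions s′ → s ≡ s′
  same-tail (here refl) (here refl) = refl
  same-tail (there (here refl)) (there (here refl)) = refl
  same-tail (here refl) (there (here ()))
  same-tail (there (here refl)) (here ())

select-⊆ : ∀ s (E : List A) → select s E ⊆ E
select-⊆ (true ∷ s) (x ∷ E) (here refl) = here refl
select-⊆ (true ∷ s) (x ∷ E) (there p) = there (select-⊆ s E p)
select-⊆ (false ∷ s) (x ∷ E) p = there (select-⊆ s E p)

select-Unique : ∀ s {E : List A} → Unique E → Unique (select s E)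
select-Unique [] _ = []
select-Unique (true ∷ s) {[]} _ = []
select-Unique (false ∷ s) {[]} _ = []
select-Unique (true ∷ s) {x ∷ E} (x∉E ∷ !E) =
  ∉⇒All≢ (select s E) (λ x∈ → All.lookup x∉E (select-⊆ s E x∈) refl) ∷ select-Unique s !E
select-Unique (false ∷ s) {x ∷ E} (_ ∷ !E) = select-Unique s !E

select-∷⁺ : ∀ b {s} {x : A} {E e} → e ∈ select s E → e ∈ select (b ∷ s) (x ∷ E)
select-∷⁺ true p = there p
select-∷⁺ false p = p

maskOf : {P : A → Set} → Decidable P → List A → List Bool
maskOf P? = map (λ x → does (P? x))

module _ {P : A → Set} (P? : Decidable P) where

  ∈-select-maskOf⁻ : ∀ E {e} → e ∈ select (maskOf P? E) E → e ∈ E × P e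
  ∈-select-maskOf⁻ (x ∷ E) p with P? x
  ∈-select-maskOf⁻ (x ∷ E) (here refl) | yes Px = here refl , Px
  ∈-select-maskOf⁻ (x ∷ E) (there p) | yes _ = map₁ there (∈-select-maskOf⁻ E p)
  ∈-select-maskOf⁻ (x ∷ E) p | no _ = map₁ there (∈-select-maskOf⁻ E p)

  ∈-select-maskOf⁺ : ∀ E {e} → e ∈ E → P e → e ∈ select (maskOf P? E) E
  ∈-select-maskOf⁺ (x ∷ E) (here refl) Px with P? x
  ... | yes _ = here refl
  ... | no ¬Px = ⊥-elim (¬Px Px)
  ∈-select-maskOf⁺ (x ∷ E) (there p) Pe with P? x
  ... | yes _ = there (∈-select-maskOf⁺ E p Pe)
  ... | no _ = ∈-select-maskOf⁺ E p Pe

  subsetᵇ-maskOf⁺ : ∀ s E → (∀ {e} → e ∈ select s E → P e) → subsetᵇ s (maskOf P? E) ≡ true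
  subsetᵇ-maskOf⁺ [] E _ = refl
  subsetᵇ-maskOf⁺ (b ∷ s) [] _ = refl
  subsetᵇ-maskOf⁺ (true ∷ s) (x ∷ E) h =
    ∧-true⁺ (dec-true (P? x) (h (here refl))) (subsetᵇ-maskOf⁺ s E (λ p → h (there p)))
  subsetᵇ-maskOf⁺ (false ∷ s) (x ∷ E) h = subsetᵇ-maskOf⁺ s E h

  eqMaskᵇ-maskOf-false : ∀ s E {e} → length s ≡ length E → e ∈ E → e ∉ select s E → P e →
    eqMaskᵇ s (maskOf P? E) ≡ false
  eqMaskᵇ-maskOf-false (true ∷ s) (x ∷ E) _ (here refl) e∉ _ = ⊥-elim (e∉ (here refl))
  eqMaskᵇ-maskOf-false (false ∷ s) (x ∷ E) _ (here refl) _ Px rewrite dec-true (P? x) Px = refl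
  eqMaskᵇ-maskOf-false (b ∷ s) (x ∷ E) ls (there e∈) e∉ Pe
    rewrite eqMaskᵇ-maskOf-false s E (suc-injective ls) e∈ (λ p → e∉ (select-∷⁺ b p)) Pe = ∧-zeroʳ _

maskOf-≡⇒ : {P R : A → Set} (P? : Decidable P) (R? : Decidable R) (E : List A) →
  maskOf P? E ≡ maskOf R? E → ∀ {e} → e ∈ E → P e → R e
maskOf-≡⇒ P? R? (x ∷ E) eq (here refl) Px = does-true⁻ (R? x) (trans (sym (proj₁ (∷-injective eq))) (dec-true (P? x) Px))
maskOf-≡⇒ P? R? (x ∷ E) eq (there p) = maskOf-≡⇒ P? R? E (proj₂ (∷-injective eq)) p

subsetᵇ-select : ∀ s t (E : List A) → length s ≡ length t → subsetᵇ s t ≡ true → select s E ⊆ select t E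
subsetᵇ-select (true ∷ s) (true ∷ t) (x ∷ E) _ _ (here refl) = here refl
subsetᵇ-select (true ∷ s) (true ∷ t) (x ∷ E) eq h (there p) =
  there (subsetᵇ-select s t E (suc-injective eq) (proj₂ (∧-true⁻ h)) p)
subsetᵇ-select (false ∷ s) (true ∷ t) (x ∷ E) eq h p =
  there (subsetᵇ-select s t E (suc-injective eq) (proj₂ (∧-true⁻ h)) p)
subsetᵇ-select (false ∷ s) (false ∷ t) (x ∷ E) eq h p =
  subsetᵇ-select s t E (suc-injective eq) (proj₂ (∧-true⁻ h)) p

properSubsetᵇ-select : ∀ s t {E : List A} → Unique E → length s ≡ length E → length t ≡ length E →
  subsetᵇ s t ≡ true → eqMaskᵇ s t ≡ false → ∃ λ e → e ∈ select t E × e ∉ select s E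
properSubsetᵇ-select (false ∷ s) (true ∷ t) {x ∷ E} (x∉E ∷ _) _ _ _ _ =
  x , here refl , λ x∈ → All.lookup x∉E (select-⊆ s E x∈) refl
properSubsetᵇ-select (true ∷ s) (true ∷ t) {x ∷ E} (x∉E ∷ !E) ls lt sub neq
  with properSubsetᵇ-select s t !E (suc-injective ls) (suc-injective lt) (proj₂ (∧-true⁻ sub)) neq
... | e , e∈t , e∉s = e , there e∈t , λ where
  (here refl) → All.lookup x∉E (select-⊆ t E e∈t) refl
  (there e∈s) → e∉s e∈s
properSubsetᵇ-select (false ∷ s) (false ∷ t) {x ∷ E} (_ ∷ !E) ls lt sub neq =
  properSubsetᵇ-select s t !E (suc-injective ls) (suc-injective lt) (proj₂ (∧-true⁻ sub)) neq
properSubsetᵇ-select [] [] {[]} _ _ _ _ ()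

select-injective : ∀ a b {E : List A} → Unique E → length a ≡ length E → length b ≡ length E →
  select a E ⊆ select b E → select b E ⊆ select a E → a ≡ b
select-injective [] [] {[]} _ _ _ _ _ = refl
select-injective (p ∷ a) (q ∷ b) {x ∷ E} (x∉E ∷ !E) la lb a⊆b b⊆a =
  cong₂ _∷_ (heads p q a⊆b b⊆a)
    (select-injective a b !E (suc-injective la) (suc-injective lb) (tails p q a⊆b) (tails q p b⊆a))
  where
  x∉ : ∀ c → x ∉ select c E
  x∉ c x∈ = All.lookup x∉E (select-⊆ c E x∈) refl
  heads : ∀ p q {a b} → select (p ∷ a) (x ∷ E) ⊆ select (q ∷ b) (x ∷ E) →
    select (q ∷ b) (x ∷ E) ⊆ select (p ∷ a) (x ∷ E) → p ≡ q
  heads true true _ _ = refl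
  heads false false _ _ = refl
  heads true false {b = b} a⊆b _ = ⊥-elim (x∉ b (a⊆b (here refl)))
  heads false true {a = a} _ b⊆a = ⊥-elim (x∉ a (b⊆a (here refl)))
  tails : ∀ p q {a b} → select (p ∷ a) (x ∷ E) ⊆ select (q ∷ b) (x ∷ E) → select a E ⊆ select b E
  tails p true {a} a⊆b e∈a with a⊆b (select-∷⁺ p e∈a)
  ... | here refl = ⊥-elim (x∉ a e∈a)
  ... | there e∈b = e∈b
  tails p false a⊆b e∈a = a⊆b (select-∷⁺ p e∈a)

-- Matchings

Edge : ℕ → Set
Edge n = Fin n × Fin n

Incident : ∀ {n} → Fin n → Edge n → Set
Incident v (a , b) = a ≡ v ⊎ b ≡ v

Overlap : ∀ {n} → Edge n → Edge n → Set
Overlap e e′ = ∃ λ v → Incident v e × Incident v e′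

overlap-sym : ∀ {n} {e e′ : Edge n} → Overlap e e′ → Overlap e′ e
overlap-sym (v , i , i′) = v , i′ , i

overlap-refl : ∀ {n} (e : Edge n) → Overlap e e
overlap-refl (a , b) = a , inj₁ refl , inj₁ refl

overlap? : ∀ {n} (e e′ : Edge n) → Dec (Overlap e e′)
overlap? (a , b) (c , d) = map′ shared⇒overlap overlap⇒shared (a ≟ c ⊎-dec a ≟ d ⊎-dec b ≟ c ⊎-dec b ≟ d)
  where
  shared⇒overlap : a ≡ c ⊎ a ≡ d ⊎ b ≡ c ⊎ b ≡ d → Overlap (a , b) (c , d)
  shared⇒overlap (inj₁ refl) = a , inj₁ refl , inj₁ refl
  shared⇒overlap (inj₂ (inj₁ refl)) = a , inj₁ refl , inj₂ refl
  shared⇒overlap (inj₂ (inj₂ (inj₁ refl))) = b , inj₂ refl , inj₁ refl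
  shared⇒overlap (inj₂ (inj₂ (inj₂ refl))) = b , inj₂ refl , inj₂ refl
  overlap⇒shared : Overlap (a , b) (c , d) → a ≡ c ⊎ a ≡ d ⊎ b ≡ c ⊎ b ≡ d
  overlap⇒shared (_ , inj₁ refl , inj₁ refl) = inj₁ refl
  overlap⇒shared (_ , inj₁ refl , inj₂ refl) = inj₂ (inj₁ refl)
  overlap⇒shared (_ , inj₂ refl , inj₁ refl) = inj₂ (inj₂ (inj₁ refl))
  overlap⇒shared (_ , inj₂ refl , inj₂ refl) = inj₂ (inj₂ (inj₂ refl))

incident? : ∀ {n} (v : Fin n) (e : Edge n) → Dec (Incident v e)
incident? v (a , b) = a ≟ v ⊎-dec b ≟ v

-- disjointᵇ e e′ is by definition not (does (overlap? e e′)).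
disjointᵇ-false⁺ : ∀ {n} {e e′ : Edge n} → Overlap e e′ → disjointᵇ e e′ ≡ false
disjointᵇ-false⁺ {e = e} {e′} o = cong not (dec-true (overlap? e e′) o)

disjointᵇ-true⁺ : ∀ {n} {e e′ : Edge n} → ¬ Overlap e e′ → disjointᵇ e e′ ≡ true
disjointᵇ-true⁺ {e = e} {e′} ¬o = cong not (dec-false (overlap? e e′) ¬o)

disjointᵇ-true⁻ : ∀ {n} {e e′ : Edge n} → disjointᵇ e e′ ≡ true → ¬ Overlap e e′
disjointᵇ-true⁻ h o = not-¬ h (disjointᵇ-false⁺ o)

IsMatching : ∀ {n} → List (Edge n) → Set
IsMatching M = ∀ {e e′} → e ∈ M → e′ ∈ M → e ≢ e′ → ¬ Overlap e e′

isMatchingᵇ-true⁻ : ∀ {n} (M : List (Edge n)) → isMatchingᵇ M ≡ true → IsMatching M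
isMatchingᵇ-true⁻ (e ∷ M) h (here refl) (here refl) e≢e′ _ = e≢e′ refl
isMatchingᵇ-true⁻ (e ∷ M) h (here refl) (there e′∈) _ =
  disjointᵇ-true⁻ (allᵇ-true⁻ (proj₁ (∧-true⁻ h)) e′∈)
isMatchingᵇ-true⁻ (e ∷ M) h (there e∈) (here refl) _ o =
  disjointᵇ-true⁻ (allᵇ-true⁻ (proj₁ (∧-true⁻ h)) e∈) (overlap-sym o)
isMatchingᵇ-true⁻ (e ∷ M) h (there e∈) (there e′∈) =
  isMatchingᵇ-true⁻ M (proj₂ (∧-true⁻ {allᵇ (disjointᵇ e) M} h)) e∈ e′∈

isMatchingᵇ-true⁺ : ∀ {n} (M : List (Edge n)) → Unique M → IsMatching M → isMatchingᵇ M ≡ true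
isMatchingᵇ-true⁺ [] _ _ = refl
isMatchingᵇ-true⁺ (e ∷ M) (e∉M ∷ !M) matching = ∧-true⁺
  (allᵇ-true⁺ M (λ e′∈ → disjointᵇ-true⁺ (matching (here refl) (there e′∈) (All.lookup e∉M e′∈))))
  (isMatchingᵇ-true⁺ M !M (λ e∈ e′∈ → matching (there e∈) (there e′∈)))

Maximal : ∀ {n} → List (Edge n) → List (Edge n) → Set
Maximal E M = ∀ {e} → e ∈ E → e ∉ M → ∃ λ e′ → e′ ∈ M × Overlap e e′

_≟ᴱ_ : ∀ {n} → DecidableEquality (Edge n)
_≟ᴱ_ = ≡-dec _≟_ _≟_

_∈ᴱ?_ : ∀ {n} (e : Edge n) (M : List (Edge n)) → Dec (e ∈ M)
e ∈ᴱ? M = any? (e ≟ᴱ_) M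

Maximal⇒overlapping : ∀ {n} {E M : List (Edge n)} → Maximal E M → ∀ {e} → e ∈ E → ∃ λ e′ → e′ ∈ M × Overlap e e′
Maximal⇒overlapping {M = M} maximal {e} e∈E with e ∈ᴱ? M
... | yes e∈M = e , e∈M , overlap-refl e
... | no e∉M = maximal e∈E e∉M

-- isMaximalMatchingᵇ G unfolds to isMaximalMatchingOfᵇ (edges G).
isMaximalMatchingOfᵇ : ∀ {n} → List (Edge n) → List Bool → Bool
isMaximalMatchingOfᵇ E s = isMatchingᵇ (select s E) ∧
  not (anyᵇ (λ t → isMatchingᵇ (select t E) ∧ properSubsetᵇ s t) (masks (length E)))

module _ {n} {E : List (Edge n)} (!E : Unique E) where

  isMaximalMatchingOfᵇ-true⁻ : ∀ s → length s ≡ length E → isMaximalMatchingOfᵇ E s ≡ true →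
    IsMatching (select s E) × Maximal E (select s E)
  isMaximalMatchingOfᵇ-true⁻ s ls h = matching , maximal
    where
    M = select s E
    matching : IsMatching M
    matching = isMatchingᵇ-true⁻ M (proj₁ (∧-true⁻ h))
    noLargerMatching = not-true⁻ (proj₂ (∧-true⁻ {isMatchingᵇ M} h))
    maximal : Maximal E M
    maximal {e} e∈E e∉M with any? (overlap? e) M
    ... | yes o = let e′ , e′∈M , o′ = find o in e′ , e′∈M , o′
    ... | no ¬o = ⊥-elim (not-¬ noLargerMatching (anyᵇ-true⁺ t∈masks (∧-true⁺ t-matching (∧-true⁺ s⊆t (cong not s≢t)))))
      where
      member? : Decidable (λ e′ → e′ ∈ M ⊎ e′ ≡ e)
      member? e′ = e′ ∈ᴱ? M ⊎-dec e′ ≟ᴱ e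
      t = maskOf member? E
      t∈masks : t ∈ masks (length E)
      t∈masks = subst (λ m → t ∈ masks m) (length-map _ E) (∈-masks t)
      t-matching : isMatchingᵇ (select t E) ≡ true
      t-matching = isMatchingᵇ-true⁺ (select t E) (select-Unique t !E) pairwise
        where
        pairwise : IsMatching (select t E)
        pairwise p p′ ne with proj₂ (∈-select-maskOf⁻ member? E p) | proj₂ (∈-select-maskOf⁻ member? E p′)
        ... | inj₁ m | inj₁ m′ = matching m m′ ne
        ... | inj₁ m | inj₂ refl = λ o → ¬o (lose m (overlap-sym o))
        ... | inj₂ refl | inj₁ m′ = λ o → ¬o (lose m′ o)
        ... | inj₂ refl | inj₂ refl = ⊥-elim (ne refl)
      s⊆t : subsetᵇ s t ≡ true
      s⊆t = subsetᵇ-maskOf⁺ member? s E inj₁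
      s≢t : eqMaskᵇ s t ≡ false
      s≢t = eqMaskᵇ-maskOf-false member? s E ls e∈E e∉M (inj₂ refl)

  isMaximalMatchingOfᵇ-maskOf⁺ : {P : Edge n → Set} (P? : Decidable P) →
    (∀ {e e′} → e ∈ E → e′ ∈ E → P e → P e′ → e ≢ e′ → ¬ Overlap e e′) →
    (∀ {e} → e ∈ E → ¬ P e → ∃ λ e′ → e′ ∈ E × P e′ × Overlap e e′) →
    isMaximalMatchingOfᵇ E (maskOf P? E) ≡ true
  isMaximalMatchingOfᵇ-maskOf⁺ P? independent dominating =
    ∧-true⁺ (isMatchingᵇ-true⁺ M (select-Unique s !E) matching) (cong not (anyᵇ-false⁺ (masks (length E)) noLarger))
    where
    s = maskOf P? E
    M = select s E
    matching : IsMatching M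
    matching p p′ with ∈-select-maskOf⁻ P? E p | ∈-select-maskOf⁻ P? E p′
    ... | e∈ , Pe | e′∈ , Pe′ = independent e∈ e′∈ Pe Pe′
    noLarger : ∀ {t} → t ∈ masks (length E) → isMatchingᵇ (select t E) ∧ properSubsetᵇ s t ≡ false
    noLarger {t} t∈ with isMatchingᵇ (select t E) ∧ properSubsetᵇ s t in larger
    ... | false = refl
    ... | true with ∧-true⁻ larger
    ... | t-matching , s⊂t with ∧-true⁻ s⊂t
    ... | s⊆t , s≢t with properSubsetᵇ-select s t !E (length-map _ E) (masks-length _ t∈) s⊆t (not-true⁻ s≢t)
    ... | e , e∈t , e∉s with P? e
    ... | yes Pe = ⊥-elim (e∉s (∈-select-maskOf⁺ P? E (select-⊆ t E e∈t) Pe))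
    ... | no ¬Pe with dominating (select-⊆ t E e∈t) ¬Pe
    ... | e′ , e′∈E , Pe′ , o = ⊥-elim (isMatchingᵇ-true⁻ (select t E) t-matching e∈t e′∈t e≢e′ o)
      where
      e′∈s = ∈-select-maskOf⁺ P? E e′∈E Pe′
      e′∈t = subsetᵇ-select s t E (trans (length-map _ E) (sym (masks-length _ t∈))) s⊆t e′∈s
      e≢e′ : e ≢ e′
      e≢e′ refl = e∉s e′∈s

greedy : ∀ {n} → List (Edge n) → List (Edge n) → List (Edge n)
greedy M [] = M
greedy M (e ∷ es) with any? (overlap? e) M
... | yes _ = greedy M es
... | no _ = greedy (e ∷ M) es

module _ {n : ℕ} where

  IsMatching-∷ : ∀ {e : Edge n} {M} → ¬ Any (Overlap e) M → IsMatching M → IsMatching (e ∷ M)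
  IsMatching-∷ _ _ (here refl) (here refl) e≢e = ⊥-elim (e≢e refl)
  IsMatching-∷ free _ (here refl) (there e′∈) _ o = free (lose e′∈ o)
  IsMatching-∷ free _ (there e∈) (here refl) _ o = free (lose e∈ (overlap-sym o))
  IsMatching-∷ _ matching (there e∈) (there e′∈) = matching e∈ e′∈

  greedy-IsMatching : ∀ (M es : List (Edge n)) → IsMatching M → IsMatching (greedy M es)
  greedy-IsMatching M [] matching = matching
  greedy-IsMatching M (e ∷ es) matching with any? (overlap? e) M
  ... | yes _ = greedy-IsMatching M es matching
  ... | no free = greedy-IsMatching (e ∷ M) es (IsMatching-∷ free matching)

  ⊆-greedy : ∀ (M es : List (Edge n)) → M ⊆ greedy M es
  ⊆-greedy M [] e∈ = e∈
  ⊆-greedy M (e ∷ es) e∈ with any? (overlap? e) M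
  ... | yes _ = ⊆-greedy M es e∈
  ... | no _ = ⊆-greedy (e ∷ M) es (there e∈)

  greedy-⊆ : ∀ (M es : List (Edge n)) {e} → e ∈ greedy M es → e ∈ M ⊎ e ∈ es
  greedy-⊆ M [] e∈ = inj₁ e∈
  greedy-⊆ M (e ∷ es) e′∈ with any? (overlap? e) M
  ... | yes _ = map₂ there (greedy-⊆ M es e′∈)
  ... | no _ with greedy-⊆ (e ∷ M) es e′∈
  ... | inj₁ (here refl) = inj₂ (here refl)
  ... | inj₁ (there e′∈M) = inj₁ e′∈M
  ... | inj₂ e′∈es = inj₂ (there e′∈es)

  greedy-dominates : ∀ (M es : List (Edge n)) {e} → e ∈ es → ∃ λ e′ → e′ ∈ greedy M es × Overlap e e′
  greedy-dominates M (e ∷ es) (here refl) with any? (overlap? e) M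
  ... | yes o = let e′ , e′∈ , o′ = find o in e′ , ⊆-greedy M es e′∈ , o′
  ... | no _ = e , ⊆-greedy (e ∷ M) es (here refl) , overlap-refl e
  greedy-dominates M (e ∷ es) (there e′∈) with any? (overlap? e) M
  ... | yes _ = greedy-dominates M es e′∈
  ... | no _ = greedy-dominates (e ∷ M) es e′∈

edgeOf : ∀ {n} → Fin n → Fin n → Edge n
edgeOf a b = if toℕ a <ᵇ toℕ b then (a , b) else (b , a)

module _ {n} (a b : Fin n) where

  Incident-edgeOf⁻ : ∀ {v} → Incident v (edgeOf a b) → v ≡ a ⊎ v ≡ b
  Incident-edgeOf⁻ i with toℕ a <ᵇ toℕ b
  Incident-edgeOf⁻ (inj₁ eq) | true = inj₁ (sym eq)
  Incident-edgeOf⁻ (inj₂ eq) | true = inj₂ (sym eq)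
  Incident-edgeOf⁻ (inj₁ eq) | false = inj₂ (sym eq)
  Incident-edgeOf⁻ (inj₂ eq) | false = inj₁ (sym eq)

  Incident-edgeOfˡ : Incident a (edgeOf a b)
  Incident-edgeOfˡ with toℕ a <ᵇ toℕ b
  ... | true = inj₁ refl
  ... | false = inj₂ refl

  Incident-edgeOfʳ : Incident b (edgeOf a b)
  Incident-edgeOfʳ with toℕ a <ᵇ toℕ b
  ... | true = inj₂ refl
  ... | false = inj₁ refl

Overlap-edgeOf⁻ : ∀ {n} (a b c d : Fin n) → Overlap (edgeOf a b) (edgeOf c d) →
  ∃ λ v → (v ≡ a ⊎ v ≡ b) × (v ≡ c ⊎ v ≡ d)
Overlap-edgeOf⁻ a b c d (v , i , i′) = v , Incident-edgeOf⁻ a b i , Incident-edgeOf⁻ c d i′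

module _ {n} (G : Graph n) where

  Adj-sym : ∀ {a b} → Adj G a b → Adj G b a
  Adj-sym {a} {b} h = trans (Graph.sym G b a) h

  Adj⇒≢ : ∀ {a b} → Adj G a b → a ≢ b
  Adj⇒≢ {a} h refl = not-¬ h (Graph.irrefl G a)

  private
    rowFilter : Fin n → List (Fin n)
    rowFilter i = filter (λ j → ((toℕ i <ᵇ toℕ j) ∧ adj G i j) ≟𝔹 true) (allFin n)

    row : Fin n → List (Edge n)
    row i = map (i ,_) (rowFilter i)

  ∈-edges⁻ : ∀ {a b} → (a , b) ∈ edges G → toℕ a < toℕ b × Adj G a b
  ∈-edges⁻ p with find (∈-concatMap⁻ row {xs = allFin n} p)
  ... | i , _ , q with ∈-map⁻ (i ,_) q
  ... | j , j∈ , refl with ∈-filter⁻ (λ j → ((toℕ i <ᵇ toℕ j) ∧ adj G i j) ≟𝔹 true) {xs = allFin n} j∈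
  ... | _ , h = <ᵇ⇒< (toℕ i) (toℕ j) (Equivalence.from T-≡ (proj₁ (∧-true⁻ h))) , proj₂ (∧-true⁻ h)

  ∈-edges⁺ : ∀ {a b} → toℕ a < toℕ b → Adj G a b → (a , b) ∈ edges G
  ∈-edges⁺ {a} {b} a<b ab = ∈-concatMap⁺ row {xs = allFin n} (lose (∈-allFin a)
    (∈-map⁺ (a ,_) (∈-filter⁺ (λ j → ((toℕ a <ᵇ toℕ j) ∧ adj G a j) ≟𝔹 true) (∈-allFin b)
      (∧-true⁺ (Equivalence.to T-≡ (<⇒<ᵇ a<b)) ab))))

  edges-Unique : Unique (edges G)
  edges-Unique = Unique-concatMap⁺ row (Unique.allFin⁺ n)
    (λ i → Unique.map⁺ (λ { refl → refl }) (Unique.filter⁺ _ (Unique.allFin⁺ n)))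
    same-row
    where
    same-row : ∀ {i i′ e} → e ∈ row i → e ∈ row i′ → i ≡ i′
    same-row {i} {i′} p q with ∈-map⁻ (i ,_) p | ∈-map⁻ (i′ ,_) q
    ... | _ , _ , refl | _ , _ , refl = refl

  edgeOf-∈-edges : ∀ {a b} → Adj G a b → edgeOf a b ∈ edges G
  edgeOf-∈-edges {a} {b} ab with toℕ a <ᵇ toℕ b in a<ᵇb
  ... | true = ∈-edges⁺ (<ᵇ⇒< (toℕ a) (toℕ b) (Equivalence.from T-≡ a<ᵇb)) ab
  ... | false = ∈-edges⁺ (≤∧≢⇒< (≮⇒≥ λ a<b → subst T a<ᵇb (<⇒<ᵇ a<b)) (λ eq → Adj⇒≢ ab (toℕ-injective (sym eq)))) (Adj-sym ab)

  ∈-edges-other-end : ∀ {e v} → e ∈ edges G → Incident v e → ∃ λ u → Adj G v u × Incident u e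
  ∈-edges-other-end {a , b} e∈ (inj₁ refl) = b , proj₂ (∈-edges⁻ e∈) , inj₂ refl
  ∈-edges-other-end {a , b} e∈ (inj₂ refl) = a , Adj-sym (proj₂ (∈-edges⁻ e∈)) , inj₁ refl

  neighbours : Fin n → List (Fin n)
  neighbours v = filter (λ u → adj G v u ≟𝔹 true) (allFin n)

  ∈-neighbours⁻ : ∀ {v u} → u ∈ neighbours v → Adj G v u
  ∈-neighbours⁻ {v} p = proj₂ (∈-filter⁻ (λ u → adj G v u ≟𝔹 true) {xs = allFin n} p)

  ∈-neighbours⁺ : ∀ {v u} → Adj G v u → u ∈ neighbours v
  ∈-neighbours⁺ {v} {u} = ∈-filter⁺ (λ u → adj G v u ≟𝔹 true) (∈-allFin u)

  neighbours-Unique : ∀ v → Unique (neighbours v)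
  neighbours-Unique v = Unique.filter⁺ _ (Unique.allFin⁺ n)

  Leaf-neighbours-≡ : ∀ {x a b} → Leaf G x → Adj G x a → Adj G x b → a ≡ b
  Leaf-neighbours-≡ {x} deg≡1 xa xb with neighbours x | deg≡1 | ∈-neighbours⁺ {x} xa | ∈-neighbours⁺ {x} xb
  ... | _ ∷ [] | _ | here refl | here refl = refl

  Incident-Leaf⇒≡edgeOf : ∀ {x y e} → Leaf G x → Adj G x y → e ∈ edges G → Incident x e → e ≡ edgeOf x y
  Incident-Leaf⇒≡edgeOf {x} {y} {.x , b} leaf xy e∈ (inj₁ refl) with ∈-edges⁻ e∈
  ... | x<b , xb rewrite Leaf-neighbours-≡ leaf xb xy with toℕ x <ᵇ toℕ y in x<ᵇy
  ...   | true = refl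
  ...   | false = ⊥-elim (subst T x<ᵇy (<⇒<ᵇ x<b))
  Incident-Leaf⇒≡edgeOf {x} {y} {a , .x} leaf xy e∈ (inj₂ refl) with ∈-edges⁻ e∈
  ... | a<x , ax rewrite Leaf-neighbours-≡ leaf (Adj-sym ax) xy with toℕ x <ᵇ toℕ y in x<ᵇy
  ...   | true = ⊥-elim (<-asym a<x (<ᵇ⇒< (toℕ x) (toℕ y) (Equivalence.from T-≡ x<ᵇy)))
  ...   | false = refl

  ¬Leaf⇒another-neighbour : ∀ {c p} → ¬ Leaf G c → Adj G c p → ∃ λ d → Adj G c d × d ≢ p
  ¬Leaf⇒another-neighbour {c} {p} ¬leaf cp with any? (λ d → ¬? (d ≟ p)) (neighbours c)
  ... | yes other = let d , d∈ , d≢p = find other in d , ∈-neighbours⁻ d∈ , d≢p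
  ... | no ¬other = ⊥-elim (¬leaf (≤-antisym
        (Unique-⊆⇒length≤ (neighbours-Unique c) only-p)
        (Unique-⊆⇒length≤ {xs = p ∷ []} ([] ∷ []) λ { (here refl) → ∈-neighbours⁺ cp })))
    where
    only-p : neighbours c ⊆ p ∷ []
    only-p {d} d∈ with d ≟ p
    ... | yes d≡p = here d≡p
    ... | no d≢p = ⊥-elim (¬other (lose d∈ d≢p))

  leafNeighbourList : Fin n → List (Fin n)
  leafNeighbourList v = filter (λ u → (adj G v u ∧ isLeaf G u) ≟𝔹 true) (allFin n)

  ∈-leafNeighbourList⁻ : ∀ {v u} → u ∈ leafNeighbourList v → Adj G v u × Leaf G u
  ∈-leafNeighbourList⁻ {v} {u} p with ∈-filter⁻ (λ u → (adj G v u ∧ isLeaf G u) ≟𝔹 true) {xs = allFin n} p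
  ... | _ , h = proj₁ (∧-true⁻ h) , ≡ᵇ⇒≡ (degree G u) 1 (Equivalence.from T-≡ (proj₂ (∧-true⁻ h)))

  ∈-leafNeighbourList⁺ : ∀ {v u} → Adj G v u → Leaf G u → u ∈ leafNeighbourList v
  ∈-leafNeighbourList⁺ {v} {u} vu leaf = ∈-filter⁺ (λ u → (adj G v u ∧ isLeaf G u) ≟𝔹 true) (∈-allFin u)
    (∧-true⁺ vu (Equivalence.to T-≡ (≡⇒≡ᵇ (degree G u) 1 leaf)))

  leafNeighbours≡0⇒¬Leaf : ∀ {v u} → leafNeighbours G v ≡ 0 → Adj G v u → ¬ Leaf G u
  leafNeighbours≡0⇒¬Leaf {v} none vu leaf with leafNeighbourList v | ∈-leafNeighbourList⁺ {v} vu leaf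
  ... | [] | ()

  leafNeighbours≢0⇒Leaf : ∀ {v} → leafNeighbours G v ≢ 0 → ∃ λ u → Adj G v u × Leaf G u
  leafNeighbours≢0⇒Leaf {v} some with leafNeighbourList v | (λ {u} → ∈-leafNeighbourList⁻ {v} {u})
  ... | [] | _ = ⊥-elim (some refl)
  ... | u ∷ _ | sound = u , sound (here refl)

  leafNeighbours≥2⇒two-leaves : ∀ {v} → leafNeighbours G v ≢ 0 → leafNeighbours G v ≢ 1 →
    ∃ λ u → ∃ λ u′ → u ≢ u′ × (Adj G v u × Leaf G u) × (Adj G v u′ × Leaf G u′)
  leafNeighbours≥2⇒two-leaves {v} ≢0 ≢1
    with leafNeighbourList v | (λ {u} → ∈-leafNeighbourList⁻ {v} {u}) | Unique.filter⁺ (λ u → (adj G v u ∧ isLeaf G u) ≟𝔹 true) (Unique.allFin⁺ n)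
  ... | [] | _ | _ = ⊥-elim (≢0 refl)
  ... | u ∷ [] | _ | _ = ⊥-elim (≢1 refl)
  ... | u ∷ u′ ∷ _ | sound | (u≢u′ ∷ _) ∷ _ = u , u′ , u≢u′ , sound (here refl) , sound (there (here refl))

-- Forests

private
  Fibre : {A : Set} {B : A → Set} → (Σ A B → Σ A B) → A → Set
  Fibre {B = B} _ = B

  Second : {A B : Set} → (A × B → A × B) → Set
  Second {B = B} _ = B

AllPairs-++⁻ˡ : {R : A → A → Set} (xs : List A) {ys : List A} → AllPairs R (xs ++ ys) → AllPairs R xs
AllPairs-++⁻ˡ [] _ = []
AllPairs-++⁻ˡ (x ∷ xs) (px ∷ pxs) = All.++⁻ˡ xs px ∷ AllPairs-++⁻ˡ xs pxs

module _ {n} (G : Graph n) where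

  Chain-++⁻ˡ : ∀ xs {ys} → Chain G (xs ++ ys) → Chain G xs
  Chain-++⁻ˡ [] _ = tt
  Chain-++⁻ˡ (x ∷ []) _ = tt
  Chain-++⁻ˡ (x ∷ x′ ∷ xs) (xx′ , chain) = xx′ , Chain-++⁻ˡ (x′ ∷ xs) chain

  -- The last-vertex function in the definition of Cycle is local, so the type of a closing edge is read off Cycle G.
  private
    ClosingEdge : (v₀ v₁ v₂ : Fin n) (rest : List (Fin n)) → Set
    ClosingEdge v₀ v₁ v₂ rest =
      Second (id {A = Second (id {A = Fibre (id {A = Fibre (id {A = Fibre (id {A = Fibre (id {A = Cycle G}) v₀}) v₁}) v₂}) rest})})

    closingEdge-snoc : ∀ {v₀ v₁ d} v₂ rest → Adj G d v₀ → ClosingEdge v₀ v₁ v₂ (rest ++ d ∷ [])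
    closingEdge-snoc v₂ [] dv₀ = dv₀
    closingEdge-snoc {v₁ = v₁} v₂ (v ∷ rest) dv₀ = closingEdge-snoc {v₁ = v₁} v rest dv₀

  closed-path⇒Cycle : ∀ {c q d} r → AllPairs _≢_ (c ∷ q ∷ r ++ d ∷ []) → Chain G (c ∷ q ∷ r ++ d ∷ []) →
    Adj G d c → Cycle G
  closed-path⇒Cycle {c} {q} {d} [] distinct chain dc = c , q , d , [] , distinct , chain , dc
  closed-path⇒Cycle {c} {q} {d} (v ∷ r) distinct chain dc = c , q , v , r ++ d ∷ [] , distinct , chain , closingEdge-snoc {v₁ = q} v r dc

  module _ (acyclic : Acyclic G) where

    no-triangle : ∀ {a b c} → Adj G a b → Adj G b c → Adj G c a → ⊥
    no-triangle ab bc ca = acyclic (closed-path⇒Cycle []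
      ((Adj⇒≢ G ab ∷ ≢-sym (Adj⇒≢ G ca) ∷ []) ∷ (Adj⇒≢ G bc ∷ []) ∷ [] ∷ []) (ab , bc , tt) ca)

    no-square : ∀ {a b c d} → Adj G a b → Adj G b c → Adj G c d → Adj G d a → a ≢ c → b ≢ d → ⊥
    no-square {c = c} ab bc cd da a≢c b≢d = acyclic (closed-path⇒Cycle (c ∷ [])
      ((Adj⇒≢ G ab ∷ a≢c ∷ ≢-sym (Adj⇒≢ G da) ∷ []) ∷ (Adj⇒≢ G bc ∷ b≢d ∷ []) ∷ (Adj⇒≢ G cd ∷ []) ∷ [] ∷ [])
      (ab , bc , cd , tt) da)

    -- Without backtracking, a walk in a forest never revisits a vertex, so it stops within n steps.
    nonBacktracking-walk-ends : {P : Fin n → Set} {Goal : Set} →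
      (∀ {p c} → Adj G p c → P c → Goal ⊎ ∃ λ d → Adj G c d × d ≢ p × P d) →
      ∀ {p c} → Adj G p c → P c → Goal
    nonBacktracking-walk-ends {P} {Goal} advance pc Pc =
      walk n (m<m+n n (s≤s z≤n)) ((Adj⇒≢ G (Adj-sym G pc) ∷ []) ∷ [] ∷ []) (Adj-sym G pc , tt) Pc
      where
      walk : ∀ fuel {c q r} → n < fuel + length (c ∷ q ∷ r) → Unique (c ∷ q ∷ r) → Chain G (c ∷ q ∷ r) → P c → Goal
      walk zero {c} {q} {r} bound distinct _ _ =
        ⊥-elim (<⇒≱ bound (subst (length (c ∷ q ∷ r) ≤_) (length-tabulate id) (Unique-⊆⇒length≤ distinct (λ {a} _ → ∈-allFin a))))
      walk (suc fuel) {c} {q} {r} bound distinct chain@(cq , _) Pc with advance (Adj-sym G cq) Pc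
      ... | inj₁ goal = goal
      ... | inj₂ (d , cd , d≢q , Pd) =
        walk fuel (subst (n <_) (sym (+-suc fuel _)) bound) (∉⇒All≢ _ d∉path ∷ distinct) (Adj-sym G cd , chain) Pd
        where
        d∉path : d ∉ c ∷ q ∷ r
        d∉path (here d≡c) = Adj⇒≢ G cd (sym d≡c)
        d∉path (there (here d≡q)) = d≢q d≡q
        d∉path (there (there d∈r)) with ∈-∃++ d∈r
        ... | r₁ , r₂ , refl = acyclic (closed-path⇒Cycle r₁
          (AllPairs-++⁻ˡ cycle (subst Unique split distinct)) (Chain-++⁻ˡ cycle (subst (Chain G) split chain)) (Adj-sym G cd))
          where
          cycle = c ∷ q ∷ r₁ ++ d ∷ []
          split : c ∷ q ∷ r₁ ++ d ∷ r₂ ≡ cycle ++ r₂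
          split = cong (λ l → c ∷ q ∷ l) (sym (++-assoc r₁ (d ∷ []) r₂))

-- Deleting the leaf of a pendant path

module _ {n} (T : Graph (suc n)) (x : Fin (suc n)) where

  punchᴱ : Edge n → Edge (suc n)
  punchᴱ (i , j) = punchIn x i , punchIn x j

  punchᴱ-injective : ∀ {e e′} → punchᴱ e ≡ punchᴱ e′ → e ≡ e′
  punchᴱ-injective {i , j} {k , l} eq =
    cong₂ _,_ (punchIn-injective x i k (cong proj₁ eq)) (punchIn-injective x j l (cong proj₂ eq))

  ¬Incident-punchᴱ : ∀ e → ¬ Incident x (punchᴱ e)
  ¬Incident-punchᴱ (i , j) (inj₁ eq) = punchInᵢ≢i x i eq
  ¬Incident-punchᴱ (i , j) (inj₂ eq) = punchInᵢ≢i x j eq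

  Overlap-punchᴱ⁺ : ∀ {e e′} → Overlap e e′ → Overlap (punchᴱ e) (punchᴱ e′)
  Overlap-punchᴱ⁺ {e} {e′} (v , i , i′) = punchIn x v , punchIncident e i , punchIncident e′ i′
    where
    punchIncident : ∀ {v} e → Incident v e → Incident (punchIn x v) (punchᴱ e)
    punchIncident _ (inj₁ refl) = inj₁ refl
    punchIncident _ (inj₂ refl) = inj₂ refl

  Overlap-punchᴱ⁻ : ∀ {e e′} → Overlap (punchᴱ e) (punchᴱ e′) → Overlap e e′
  Overlap-punchᴱ⁻ {i , j} {k , l} (v , inj₁ refl , inj₁ eq) = i , inj₁ refl , inj₁ (punchIn-injective x k i eq)
  Overlap-punchᴱ⁻ {i , j} {k , l} (v , inj₁ refl , inj₂ eq) = i , inj₁ refl , inj₂ (punchIn-injective x l i eq)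
  Overlap-punchᴱ⁻ {i , j} {k , l} (v , inj₂ refl , inj₁ eq) = j , inj₂ refl , inj₁ (punchIn-injective x k j eq)
  Overlap-punchᴱ⁻ {i , j} {k , l} (v , inj₂ refl , inj₂ eq) = j , inj₂ refl , inj₂ (punchIn-injective x l j eq)

  punchᴱ-∈-edges : ∀ {e} → e ∈ edges (delete T x) → punchᴱ e ∈ edges T
  punchᴱ-∈-edges {i , j} e∈ with ∈-edges⁻ (delete T x) e∈
  ... | i<j , ij = ∈-edges⁺ T (≰⇒> λ j≤i → <⇒≱ i<j (punchIn-cancel-≤ x j i j≤i)) ij

  edges-avoiding : ∀ {e} → e ∈ edges T → ¬ Incident x e → ∃ λ e′ → e′ ∈ edges (delete T x) × punchᴱ e′ ≡ e
  edges-avoiding {a , b} e∈ ¬x =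
    (punchOut x≢a , punchOut x≢b) , ∈-edges⁺ (delete T x) a′<b′ a′b′ , cong₂ _,_ a′↦a b′↦b
    where
    x≢a : x ≢ a
    x≢a eq = ¬x (inj₁ (sym eq))
    x≢b : x ≢ b
    x≢b eq = ¬x (inj₂ (sym eq))
    a′↦a = punchIn-punchOut x≢a
    b′↦b = punchIn-punchOut x≢b
    a′<b′ : toℕ (punchOut x≢a) < toℕ (punchOut x≢b)
    a′<b′ = ≰⇒> λ b′≤a′ → <⇒≱ (proj₁ (∈-edges⁻ T e∈))
      (subst₂ (λ u v → toℕ u ≤ toℕ v) b′↦b a′↦a (punchIn-mono-≤ x _ _ b′≤a′))
    a′b′ : Adj (delete T x) (punchOut x≢a) (punchOut x≢b)
    a′b′ = subst₂ (Adj T) (sym a′↦a) (sym b′↦b) (proj₂ (∈-edges⁻ T e∈))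

module Lift {n} {T : Graph (suc n)} {x y : Fin (suc n)} (x-leaf : Leaf T x) (xy : Adj T x y) where

  private
    E = edges T
    E′ = edges (delete T x)
    punch = punchᴱ T x

  Covers : Fin (suc n) → List (Edge n) → Set
  Covers v M′ = Any (λ e′ → Incident v (punch e′)) M′

  Lifted : List (Edge n) → Edge (suc n) → Set
  Lifted M′ e = e ∈ map punch M′ ⊎ (Incident x e × ¬ Covers y M′)

  lifted? : ∀ M′ → Decidable (Lifted M′)
  lifted? M′ e = e ∈ᴱ? map punch M′ ⊎-dec (incident? x e ×-dec ¬? (any? (λ e′ → incident? y (punch e′)) M′))

  lift : List Bool → List Bool
  lift a = maskOf (lifted? (select a E′)) E

  IsMaximalMask′ : List Bool → Set
  IsMaximalMask′ a = length a ≡ length E′ × isMaximalMatchingOfᵇ E′ a ≡ true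

  private
    x-edge : ∀ {e} → e ∈ E → Incident x e → e ≡ edgeOf x y
    x-edge = Incident-Leaf⇒≡edgeOf T x-leaf xy

    punch-∈-select : ∀ a {e′} → e′ ∈ select a E′ → punch e′ ∈ select (lift a) E
    punch-∈-select a e′∈ = ∈-select-maskOf⁺ (lifted? (select a E′)) E
      (punchᴱ-∈-edges T x (select-⊆ a E′ e′∈)) (inj₁ (∈-map⁺ punch e′∈))

    xy-lifted⇒y-free : ∀ {M′} → Lifted M′ (edgeOf x y) → ¬ Covers y M′
    xy-lifted⇒y-free (inj₁ p) with ∈-map⁻ punch p
    ... | e′ , _ , eq = ⊥-elim (¬Incident-punchᴱ T x e′ (subst (Incident x) eq (Incident-edgeOfˡ x y)))
    xy-lifted⇒y-free (inj₂ (_ , ¬covers)) = ¬covers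

    yw-avoids-x : ∀ {w} → Adj T y w → w ≢ x → ¬ Incident x (edgeOf y w)
    yw-avoids-x {w} yw w≢x i with Incident-edgeOf⁻ y w i
    ... | inj₁ x≡y = Adj⇒≢ T xy x≡y
    ... | inj₂ x≡w = w≢x (sym x≡w)

  lift-maximal : ∀ {a} → IsMaximalMask′ a → isMaximalMatchingOfᵇ E (lift a) ≡ true
  lift-maximal {a} (la , h) with isMaximalMatchingOfᵇ-true⁻ (edges-Unique (delete T x)) a la h
  ... | matching′ , maximal′ =
    isMaximalMatchingOfᵇ-maskOf⁺ (edges-Unique T) (lifted? M′) independent dominating
    where
    M′ = select a E′
    image-vs-x : ∀ {e₁′ e₂} → e₁′ ∈ M′ → e₂ ∈ E → Incident x e₂ × ¬ Covers y M′ → ¬ Overlap (punch e₁′) e₂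
    image-vs-x {e₁′} e₁′∈ e₂∈ (x∈e₂ , ¬covers) (v , v∈e₁ , v∈e₂)
      with Incident-edgeOf⁻ x y (subst (Incident v) (x-edge e₂∈ x∈e₂) v∈e₂)
    ... | inj₁ refl = ¬Incident-punchᴱ T x e₁′ v∈e₁
    ... | inj₂ refl = ¬covers (lose e₁′∈ v∈e₁)
    independent : ∀ {e₁ e₂} → e₁ ∈ E → e₂ ∈ E → Lifted M′ e₁ → Lifted M′ e₂ → e₁ ≢ e₂ → ¬ Overlap e₁ e₂
    independent _ _ (inj₁ p₁) (inj₁ p₂) e₁≢e₂ with ∈-map⁻ punch p₁ | ∈-map⁻ punch p₂
    ... | e₁′ , e₁′∈ , refl | e₂′ , e₂′∈ , refl =
      λ o → matching′ e₁′∈ e₂′∈ (λ eq → e₁≢e₂ (cong punch eq)) (Overlap-punchᴱ⁻ T x o)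
    independent _ e₂∈ (inj₁ p₁) (inj₂ at-x) _ with ∈-map⁻ punch p₁
    ... | e₁′ , e₁′∈ , refl = image-vs-x e₁′∈ e₂∈ at-x
    independent e₁∈ _ (inj₂ at-x) (inj₁ p₂) _ with ∈-map⁻ punch p₂
    ... | e₂′ , e₂′∈ , refl = λ o → image-vs-x e₂′∈ e₁∈ at-x (overlap-sym o)
    independent e₁∈ e₂∈ (inj₂ (x∈e₁ , _)) (inj₂ (x∈e₂ , _)) e₁≢e₂ =
      ⊥-elim (e₁≢e₂ (trans (x-edge e₁∈ x∈e₁) (sym (x-edge e₂∈ x∈e₂))))
    dominating : ∀ {e} → e ∈ E → ¬ Lifted M′ e → ∃ λ e′ → e′ ∈ E × Lifted M′ e′ × Overlap e e′
    dominating {e} e∈ ¬lifted with incident? x e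
    ... | yes x∈e with any? (λ e′ → incident? y (punch e′)) M′
    ...   | no ¬covers = ⊥-elim (¬lifted (inj₂ (x∈e , ¬covers)))
    ...   | yes covers with find covers
    ...     | e′ , e′∈ , y∈e′ = punch e′ , punchᴱ-∈-edges T x (select-⊆ a E′ e′∈) , inj₁ (∈-map⁺ punch e′∈) ,
                              y , subst (Incident y) (sym (x-edge e∈ x∈e)) (Incident-edgeOfʳ x y) , y∈e′
    dominating {e} e∈ ¬lifted | no x∉e with edges-avoiding T x e∈ x∉e
    ... | e′ , e′∈E′ , refl with maximal′ e′∈E′ (λ e′∈ → ¬lifted (inj₁ (∈-map⁺ punch e′∈)))
    ... | e₂′ , e₂′∈ , o = punch e₂′ , punchᴱ-∈-edges T x (select-⊆ a E′ e₂′∈) , inj₁ (∈-map⁺ punch e₂′∈) ,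
                          Overlap-punchᴱ⁺ T x o

  lift-injective : ∀ {a b} → IsMaximalMask′ a → IsMaximalMask′ b → lift a ≡ lift b → a ≡ b
  lift-injective {a} {b} (la , _) (lb , _) eq =
    select-injective a b (edges-Unique (delete T x)) la lb (transfer a b eq) (transfer b a (sym eq))
    where
    transfer : ∀ a b → lift a ≡ lift b → select a E′ ⊆ select b E′
    transfer a b eq e′∈a
      with maskOf-≡⇒ (lifted? (select a E′)) (lifted? (select b E′)) E eq
             (punchᴱ-∈-edges T x (select-⊆ a E′ e′∈a)) (inj₁ (∈-map⁺ punch e′∈a))
    ... | inj₁ p with ∈-map⁻ punch p
    ...   | e″ , e″∈b , eq′ = subst (_∈ select b E′) (sym (punchᴱ-injective T x eq′)) e″∈b
    transfer a b eq {e′} e′∈a | inj₂ (x∈ , _) = ⊥-elim (¬Incident-punchᴱ T x e′ x∈)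

  lift-covers-neighbour : ∀ {a w} → IsMaximalMask′ a → Adj T y w → w ≢ x →
    edgeOf x y ∈ select (lift a) E → ∃ λ e → e ∈ select (lift a) E × Incident w e
  lift-covers-neighbour {a} {w} (la , h) yw w≢x xy∈
    with isMaximalMatchingOfᵇ-true⁻ (edges-Unique (delete T x)) a la h
       | xy-lifted⇒y-free (proj₂ (∈-select-maskOf⁻ (lifted? (select a E′)) E xy∈))
  ... | _ , maximal′ | y-free with edges-avoiding T x (edgeOf-∈-edges T yw) (yw-avoids-x yw w≢x)
  ... | e′ , e′∈E′ , punch-e′ with Maximal⇒overlapping maximal′ e′∈E′
  ... | e₂′ , e₂′∈ , o with subst (λ e → Overlap e (punch e₂′)) punch-e′ (Overlap-punchᴱ⁺ T x o)
  ... | v , v∈yw , v∈e₂ with Incident-edgeOf⁻ y w v∈yw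
  ...   | inj₁ refl = ⊥-elim (y-free (lose e₂′∈ v∈e₂))
  ...   | inj₂ refl = punch e₂′ , punch-∈-select a e₂′∈ , v∈e₂

record PendantPath {n} (T : Graph n) : Set where
  field
    x y w : Fin n
    x-leaf : Leaf T x
    xy : Adj T x y
    yw : Adj T y w
    w≢x : w ≢ x
    w-neighbours : ∀ {u} → Adj T w u → u ≢ y → ¬ Leaf T u

module Unlifted {n} {T : Graph n} (acyclic : Acyclic T) (path : PendantPath T) where

  open PendantPath path

  private
    E = edges T

    x-neighbour : ∀ {z} → Adj T x z → z ≡ y
    x-neighbour xz = Leaf-neighbours-≡ T x-leaf xz xy

    w≢y : w ≢ y
    w≢y w≡y = Adj⇒≢ T yw (sym w≡y)

  -- Together with xy, the spokes block every neighbour of w, so that w stays unmatched.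
  spokes : Fin n → List (Edge n)
  spokes u with adj T w u ≟𝔹 true | u ≟ y
  ... | yes wu | no u≢y = edgeOf u (proj₁ (¬Leaf⇒another-neighbour T (w-neighbours wu u≢y) (Adj-sym T wu))) ∷ []
  ... | _ | _ = []

  Spoke : Fin n → Edge n → Set
  Spoke u e = ∃ λ z → e ≡ edgeOf u z × Adj T w u × u ≢ y × Adj T u z × z ≢ w

  ∈-spokes⁻ : ∀ {u e} → e ∈ spokes u → Spoke u e
  ∈-spokes⁻ {u} with adj T w u ≟𝔹 true | u ≟ y
  ... | yes wu | no u≢y = λ { (here refl) →
        let z , uz , z≢w = ¬Leaf⇒another-neighbour T (w-neighbours wu u≢y) (Adj-sym T wu)
        in z , refl , wu , u≢y , uz , z≢w }
  ... | yes _ | yes _ = λ ()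
  ... | no _ | _ = λ ()

  spokes-unique : ∀ {u e e′} → e ∈ spokes u → e′ ∈ spokes u → e ≡ e′
  spokes-unique {u} with adj T w u ≟𝔹 true | u ≟ y
  ... | yes _ | no _ = λ { (here refl) (here refl) → refl }
  ... | yes _ | yes _ = λ ()
  ... | no _ | _ = λ ()

  spokes-nonempty : ∀ {u} → Adj T w u → u ≢ y → ∃ λ e → e ∈ spokes u
  spokes-nonempty {u} wu u≢y with adj T w u ≟𝔹 true | u ≟ y
  ... | yes _ | no _ = _ , here refl
  ... | yes _ | yes u≡y = ⊥-elim (u≢y u≡y)
  ... | no ¬wu | _ = ⊥-elim (¬wu wu)

  seed : List (Edge n)
  seed = edgeOf x y ∷ concatMap spokes (allFin n)

  ∈-seed⁻ : ∀ {e} → e ∈ seed → e ≡ edgeOf x y ⊎ ∃ λ u → e ∈ spokes u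
  ∈-seed⁻ (here refl) = inj₁ refl
  ∈-seed⁻ (there e∈) with find (∈-concatMap⁻ spokes {xs = allFin n} e∈)
  ... | u , _ , e∈u = inj₂ (u , e∈u)

  seed-⊆ : seed ⊆ E
  seed-⊆ e∈ with ∈-seed⁻ e∈
  ... | inj₁ refl = edgeOf-∈-edges T xy
  ... | inj₂ (u , e∈u) with ∈-spokes⁻ e∈u
  ...   | z , refl , _ , _ , uz , _ = edgeOf-∈-edges T uz

  spoke-vs-spoke : ∀ {u u′ e e′} → e ∈ spokes u → e′ ∈ spokes u′ → u ≢ u′ → ¬ Overlap e e′
  spoke-vs-spoke {u} {u′} s∈ s′∈ u≢u′ o with ∈-spokes⁻ s∈ | ∈-spokes⁻ s′∈
  ... | z , refl , wu , _ , uz , z≢w | z′ , refl , wu′ , _ , u′z′ , _ with Overlap-edgeOf⁻ u z u′ z′ o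
  ...   | _ , inj₁ refl , inj₁ refl = u≢u′ refl
  ...   | _ , inj₁ refl , inj₂ refl = no-triangle T acyclic wu (Adj-sym T u′z′) (Adj-sym T wu′)
  ...   | _ , inj₂ refl , inj₁ refl = no-triangle T acyclic wu uz (Adj-sym T wu′)
  ...   | _ , inj₂ refl , inj₂ refl = no-square T acyclic wu uz (Adj-sym T u′z′) (Adj-sym T wu′) (≢-sym z≢w) u≢u′
  xy-vs-spoke : ∀ {u e} → e ∈ spokes u → ¬ Overlap (edgeOf x y) e
  xy-vs-spoke {u} s∈ o with ∈-spokes⁻ s∈
  ... | z , refl , wu , u≢y , uz , _ with Overlap-edgeOf⁻ x y u z o
  ...   | _ , inj₁ refl , inj₁ refl = w≢y (x-neighbour (Adj-sym T wu))
  ...   | _ , inj₁ refl , inj₂ refl = u≢y (x-neighbour (Adj-sym T uz))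
  ...   | _ , inj₂ refl , inj₁ refl = u≢y refl
  ...   | _ , inj₂ refl , inj₂ refl = no-triangle T acyclic yw wu uz

  seed-IsMatching : IsMatching seed
  seed-IsMatching e∈ e′∈ e≢e′ o with ∈-seed⁻ e∈ | ∈-seed⁻ e′∈
  ... | inj₁ refl | inj₁ refl = e≢e′ refl
  ... | inj₁ refl | inj₂ (u , s∈) = xy-vs-spoke s∈ o
  ... | inj₂ (u , s∈) | inj₁ refl = xy-vs-spoke s∈ (overlap-sym o)
  ... | inj₂ (u , s∈) | inj₂ (u′ , s′∈) = spoke-vs-spoke s∈ s′∈ (λ { refl → e≢e′ (spokes-unique s∈ s′∈) }) o

  matched : List (Edge n)
  matched = greedy seed E

  matched-IsMatching : IsMatching matched
  matched-IsMatching = greedy-IsMatching seed E seed-IsMatching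

  matched-⊆ : matched ⊆ E
  matched-⊆ e∈ with greedy-⊆ seed E e∈
  ... | inj₁ e∈seed = seed-⊆ e∈seed
  ... | inj₂ e∈E = e∈E

  w-unmatched : ∀ {e} → e ∈ matched → ¬ Incident w e
  w-unmatched {e} e∈ w∈e with ∈-edges-other-end T (matched-⊆ e∈) w∈e
  ... | u , wu , u∈e with u ≟ y
  ... | yes refl = matched-IsMatching e∈ (⊆-greedy seed E (here refl)) e≢xy (y , u∈e , Incident-edgeOfʳ x y)
    where
    e≢xy : e ≢ edgeOf x y
    e≢xy refl with Incident-edgeOf⁻ x y w∈e
    ... | inj₁ w≡x = w≢x w≡x
    ... | inj₂ w≡y = w≢y w≡y
  ... | no u≢y with spokes-nonempty wu u≢y
  ... | s , s∈ with ∈-spokes⁻ s∈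
  ... | z , refl , _ , _ , _ , z≢w =
    matched-IsMatching e∈ (⊆-greedy seed E (there (∈-concatMap⁺ spokes {xs = allFin n} (lose (∈-allFin u) s∈))))
      e≢s (u , u∈e , Incident-edgeOfˡ u z)
    where
    e≢s : e ≢ edgeOf u z
    e≢s refl with Incident-edgeOf⁻ u z w∈e
    ... | inj₁ w≡u = Adj⇒≢ T wu w≡u
    ... | inj₂ w≡z = z≢w (sym w≡z)

  unlifted : List Bool
  unlifted = maskOf (_∈ᴱ? matched) E

  unlifted-maximal : isMaximalMatchingOfᵇ E unlifted ≡ true
  unlifted-maximal = isMaximalMatchingOfᵇ-maskOf⁺ (edges-Unique T) (_∈ᴱ? matched)
    (λ _ _ e∈ e′∈ → matched-IsMatching e∈ e′∈)
    (λ e∈E _ → let e′ , e′∈ , o = greedy-dominates seed E e∈E in e′ , matched-⊆ e′∈ , e′∈ , o)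

  xy-∈-unlifted : edgeOf x y ∈ select unlifted E
  xy-∈-unlifted = ∈-select-maskOf⁺ (_∈ᴱ? matched) E (edgeOf-∈-edges T xy) (⊆-greedy seed E (here refl))

  w-∉-unlifted : ∀ {e} → e ∈ select unlifted E → ¬ Incident w e
  w-∉-unlifted e∈ = w-unmatched (proj₂ (∈-select-maskOf⁻ (_∈ᴱ? matched) E e∈))

maximalMasks : ∀ {n} → Graph n → List (List Bool)
maximalMasks G = filter (λ s → isMaximalMatchingᵇ G s ≟𝔹 true) (masks (length (edges G)))

module _ {n} (G : Graph n) where

  maximalMasks-Unique : Unique (maximalMasks G)
  maximalMasks-Unique = Unique.filter⁺ (λ s → isMaximalMatchingᵇ G s ≟𝔹 true) (masks-Unique (length (edges G)))

  ∈-maximalMasks⁻ : ∀ {s} → s ∈ maximalMasks G → length s ≡ length (edges G) × isMaximalMatchingᵇ G s ≡ true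
  ∈-maximalMasks⁻ s∈ with ∈-filter⁻ (λ s → isMaximalMatchingᵇ G s ≟𝔹 true) {xs = masks (length (edges G))} s∈
  ... | s∈masks , maximal = masks-length _ s∈masks , maximal

  ∈-maximalMasks⁺ : ∀ {s} → length s ≡ length (edges G) → isMaximalMatchingᵇ G s ≡ true → s ∈ maximalMasks G
  ∈-maximalMasks⁺ {s} ls = ∈-filter⁺ (λ s → isMaximalMatchingᵇ G s ≟𝔹 true) (subst (λ m → s ∈ masks m) ls (∈-masks s))

Ψ-delete-< : ∀ {n} {T : Graph (suc n)} → Acyclic T → (path : PendantPath T) →
  Ψ (delete T (PendantPath.x path)) < Ψ T
Ψ-delete-< {T = T} acyclic path =
  injection-missing⇒length< lift {maximalMasks T′} {maximalMasks T} (maximalMasks-Unique T′)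
    (λ {a} {b} a∈ b∈ → lift-injective {a} {b} (∈-maximalMasks⁻ T′ a∈) (∈-maximalMasks⁻ T′ b∈))
    (λ {a} a∈ → ∈-maximalMasks⁺ T (length-map _ (edges T)) (lift-maximal {a} (∈-maximalMasks⁻ T′ a∈)))
    unlifted (∈-maximalMasks⁺ T (length-map _ (edges T)) unlifted-maximal) lift≢unlifted
  where
  open PendantPath path
  open Lift {T = T} x-leaf xy
  open Unlifted acyclic path
  T′ = delete T x
  lift≢unlifted : ∀ {a} → a ∈ maximalMasks T′ → lift a ≢ unlifted
  lift≢unlifted {a} a∈ eq with lift-covers-neighbour {a} (∈-maximalMasks⁻ T′ a∈) yw w≢x (subst (λ m → edgeOf x y ∈ select m (edges T)) (sym eq) xy-∈-unlifted)
  ... | e , e∈ , w∈e = w-∉-unlifted (subst (λ m → e ∈ select m (edges T)) eq e∈) w∈e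

Ψ-stable⇒¬PendantPath : ∀ {n} {T : Graph (suc n)} → Acyclic T →
  (∀ x → Leaf T x → Ψ T ≡ Ψ (delete T x)) → ¬ PendantPath T
Ψ-stable⇒¬PendantPath acyclic Ψ-stable path = <-irrefl (sym (Ψ-stable x x-leaf)) (Ψ-delete-< acyclic path)
  where open PendantPath path

-- Finding a pendant path

module _ {n} {T : Graph n} where

  two-leaves⇒PendantPath : ∀ {v u u′} → u ≢ u′ → Adj T v u → Leaf T u → Adj T v u′ → Leaf T u′ → PendantPath T
  two-leaves⇒PendantPath {v} {u} {u′} u≢u′ vu u-leaf vu′ u′-leaf = record
    { x = u ; y = v ; w = u′ ; x-leaf = u-leaf ; xy = Adj-sym T vu ; yw = vu′ ; w≢x = ≢-sym u≢u′
    ; w-neighbours = λ u′z z≢v → ⊥-elim (z≢v (Leaf-neighbours-≡ T u′-leaf u′z (Adj-sym T vu′))) }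

  Bare : Fin n → Set
  Bare c = ¬ Leaf T c × (∀ {u} → Adj T c u → ¬ Leaf T u)

  Bare-step : ∀ {p c} → Adj T p c → Bare c → PendantPath T ⊎ ∃ λ d → Adj T c d × d ≢ p × Bare d
  Bare-step pc (¬leaf , ¬leaf-neighbour) with ¬Leaf⇒another-neighbour T ¬leaf (Adj-sym T pc)
  ... | d , cd , d≢p with leafNeighbours T d ≟ℕ 0
  ... | yes none = inj₂ (d , cd , d≢p , ¬leaf-neighbour cd , leafNeighbours≡0⇒¬Leaf T none)
  ... | no some with leafNeighbours≢0⇒Leaf T some
  ... | x , dx , x-leaf = inj₁ (record
    { x = x ; y = d ; w = _ ; x-leaf = x-leaf ; xy = Adj-sym T dx ; yw = Adj-sym T cd
    ; w≢x = λ c≡x → ¬leaf (subst (Leaf T) (sym c≡x) x-leaf) ; w-neighbours = λ cu _ → ¬leaf-neighbour cu })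

  Bare⇒PendantPath : Acyclic T → ∀ {v d} → Adj T v d → Bare v → PendantPath T
  Bare⇒PendantPath acyclic vd = nonBacktracking-walk-ends T acyclic Bare-step (Adj-sym T vd)

  Walk⇒neighbour : ∀ {u v} → Walk T u v → u ≢ v → ∃ λ d → Adj T u d
  Walk⇒neighbour here u≢u = ⊥-elim (u≢u refl)
  Walk⇒neighbour (step ud _) _ = _ , ud

another : ∀ {k} (v : Fin (suc (suc k))) → ∃ λ u → v ≢ u
another zero = suc zero , λ ()
another (suc _) = zero , λ ()

corollary3p7 : (n : ℕ) (T : Graph (suc n)) → IsTree T → 3 ≤ suc n →
    (∀ x → Leaf T x → Ψ T ≡ Ψ (delete T x)) →
    ∀ v → ¬ Leaf T v → leafNeighbours T v ≡ 1
corollary3p7 zero _ _ (s≤s ())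
corollary3p7 (suc k) T (connected , acyclic) _ Ψ-stable v ¬leaf with leafNeighbours T v ≟ℕ 0 | leafNeighbours T v ≟ℕ 1
... | _ | yes one = one
... | no ≢0 | no ≢1 =
  let u , u′ , u≢u′ , (vu , u-leaf) , (vu′ , u′-leaf) = leafNeighbours≥2⇒two-leaves T ≢0 ≢1
  in ⊥-elim (Ψ-stable⇒¬PendantPath acyclic Ψ-stable (two-leaves⇒PendantPath u≢u′ vu u-leaf vu′ u′-leaf))
... | yes none | no _ =
  let u , v≢u = another v
      d , vd = Walk⇒neighbour (connected v u) v≢u
  in ⊥-elim (Ψ-stable⇒¬PendantPath acyclic Ψ-stable (Bare⇒PendantPath acyclic vd (¬leaf , leafNeighbours≡0⇒¬Leaf T none)))
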